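{- Let $q$ be a prime power and $r\ge1$. Let $(E_0,E_1,\dots,E_k)$ and $(F_0,F_1,\dots,F_k)$ be nested sequences of flats in $AG(r-1,q)$ such that $r(E_i)=r(F_i)$ for all $i\in\{0,1,\dots,k\}$. Let $G_E$ be the union of all sets $E_{i+1}-E_i$ and $G_F$ the union of all sets $F_{i+1}-F_i$, taken over the even numbers $i$ with $0\le i\le k-1$. Then $AG(r-1,q)|G_E\cong AG(r-1,q)|G_F$.
   Context: $AG(r-1,q)$ denotes the rank-$r$ affine geometry over $GF(q)$. A nested sequence of flats in $AG(r-1,q)$ is a sequence $(F_0,\dots,F_k)$ of possibly empty flats of $AG(r-1,q)$ with $\emptyset=F_0\subseteq F_1\subseteq\dots\subseteq F_k=E(AG(r-1,q))$. -}

module Defs where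

open import Level using (0ℓ)
open import Data.Nat using (ℕ; zero; suc; _≤_; _<_; _^_) renaming (_*_ to _ℕ*_)
open import Data.Nat.Primality using (Prime)
open import Data.Fin using (Fin)
import Data.Vec
open import Data.Vec using (Vec; replicate; zipWith)
open import Data.List using (List; []; _∷_; length; map)
open import Data.List.Relation.Unary.All using (All)
open import Data.Product using (Σ; ∃; ∃-syntax; _×_; _,_)
open import Relation.Binary.PropositionalEquality using (_≡_)
open import Relation.Nullary using (¬_)
open import Function.Bundles using (_↔_; _⇔_)
open import Algebra.Structures using (IsCommutativeRing)

IsPrimePower : ℕ → Set
IsPrimePower q = ∃[ p ] ∃[ m ] (Prime p × 1 ≤ m × q ≡ p ^ m)

record Field : Set₁ where
  infixl 6 _+_
  infixl 7 _*_
  field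
    Carrier : Set
    _+_ _*_ : Carrier → Carrier → Carrier
    -_      : Carrier → Carrier
    0# 1#   : Carrier
    isCommutativeRing : IsCommutativeRing _≡_ _+_ _*_ -_ 0# 1#
    0≢1     : ¬ (0# ≡ 1#)
    inverse : ∀ x → ¬ (x ≡ 0#) → ∃[ y ] (x * y ≡ 1#)

HasOrder : Field → ℕ → Set
HasOrder F q = Field.Carrier F ↔ Fin q

-- The affine geometry AG(n,F) as a matroid on F^n:
-- a list of points is independent iff it is affinely independent.

module AffineGeometry (F : Field) (n : ℕ) where
  open Field F

  Point : Set
  Point = Vec Carrier n

  Subset : Set₁
  Subset = Point → Set

  _∈_ : Point → Subset → Set
  x ∈ S = S x

  origin : Point
  origin = replicate n 0#

  _⊕_ : Point → Point → Point
  _⊕_ = zipWith _+_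

  _·_ : Carrier → Point → Point
  c · x = Data.Vec.map (c *_) x

  sumScalars : List Carrier → Carrier
  sumScalars []       = 0#
  sumScalars (c ∷ cs) = c + sumScalars cs

  -- Σ cᵢ xᵢ over the common prefix of the two lists
  combination : List Carrier → List Point → Point
  combination (c ∷ cs) (x ∷ xs) = (c · x) ⊕ combination cs xs
  combination _        _        = origin

  Independent : List Point → Set
  Independent xs =
    ∀ (cs : List Carrier) → length cs ≡ length xs →
      sumScalars cs ≡ 0# → combination cs xs ≡ origin →
      All (_≡ 0#) cs

  -- Matroid rank: r(X) = n iff X contains an independent list of length n
  -- and every independent list in X has length ≤ n.
  -- (Affine independence forces the points of an independent list to be distinct.)
  HasRank : Subset → ℕ → Set
  HasRank X k =
    (∃[ xs ] (All (_∈ X) xs × Independent xs × length xs ≡ k)) ×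
    (∀ xs → All (_∈ X) xs → Independent xs → length xs ≤ k)

  -- Flats of AG(n,F): sets closed under the matroid closure, i.e. under
  -- affine combinations (coefficients summing to 1) of their points.
  -- The empty set is a flat.
  IsFlat : Subset → Set
  IsFlat X =
    ∀ (xs : List Point) (cs : List Carrier) → All (_∈ X) xs →
      length cs ≡ length xs → sumScalars cs ≡ 1# →
      combination cs xs ∈ X

  NestedFlats : ℕ → (ℕ → Subset) → Set
  NestedFlats k X =
    (∀ i → i ≤ k → IsFlat (X i)) ×
    (∀ x → ¬ (x ∈ X 0)) ×
    (∀ i → i < k → ∀ x → x ∈ X i → x ∈ X (suc i)) ×
    (∀ x → x ∈ X k)

  EvenLayers : ℕ → (ℕ → Subset) → Subset
  EvenLayers k X x =
    ∃[ j ] ((2 ℕ* j) < k × x ∈ X (suc ((2 ℕ* j))) × ¬ (x ∈ X ((2 ℕ* j))))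

  RestrictionIso : Subset → Subset → Set
  RestrictionIso A B =
    Σ (Point → Point) λ φ → Σ (Point → Point) λ ψ →
      ((∀ x → x ∈ A → φ x ∈ B) ×
       (∀ y → y ∈ B → ψ y ∈ A) ×
       (∀ x → x ∈ A → ψ (φ x) ≡ x) ×
       (∀ y → y ∈ B → φ (ψ y) ≡ y) ×
       (∀ xs → All (_∈ A) xs → (Independent xs ⇔ Independent (map φ xs))))

-- Over a finite field a nested sequence of flats admits an adapted affine basis: one
-- independent list e spanning the whole space such that, for every i, a suffix of e is
-- a basis of the i-th flat.  In the affine coordinates given by e, the i-th flat is then
-- the set of points whose coordinates vanish outside the last r(E_i) positions.  Two
-- flags with the same ranks therefore have the same description in coordinates, so the
-- affine map sending the adapted basis of one flag to that of the other carries every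
-- E_i onto the corresponding G_i; being affine it preserves independence, and it maps
-- the even layers onto each other.
module Submission where

open import Defs
open import Data.Nat using (ℕ; _≥_; _∸_; _≤_)
open import Data.Product using (∃-syntax; _×_)

open import Level using (0ℓ)
open import Data.Nat using (zero; suc; _<_; _^_; z≤n; s≤s)
import Data.Nat as Nat
import Data.Nat.Properties as NatP
open import Data.Fin using (Fin)
import Data.Fin as Fin
import Data.Fin.Properties as FinP
open import Data.Vec using (Vec; []; _∷_; toList)
import Data.Vec.Properties as VecP
open import Data.Vec.Recursive using (lift↔; Fin[m^n]↔Fin[m]^n)
open import Data.Vec.Recursive.Properties using (↔Vec)
open import Data.List using (List; []; _∷_; length; map; _++_)
import Data.List as List
import Data.List.Properties as ListP
open import Data.List.Relation.Unary.All using (All; []; _∷_)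
import Data.List.Relation.Unary.All as All
open import Data.List.Relation.Unary.All.Properties using (replicate⁺)
open import Data.List.Relation.Binary.Pointwise using (Pointwise; []; _∷_; Pointwise-length)
open import Data.Product using (∃; ∃₂; _,_; proj₁; proj₂)
import Data.Product as Product
open import Data.Sum using (_⊎_; inj₁; inj₂)
open import Function using (_∘_)
open import Function.Bundles using (_↔_; _⇔_; _↣_; Inverse; Injection; Equivalence; mk⇔; mk↣)
open import Function.Definitions using (Injective)
open import Function.Properties.Inverse using (↔-sym; ↔-trans; ↔⇒↣)
open import Function.Construct.Composition using (_↣-∘_; _⇔-∘_)
open import Function.Construct.Symmetry using (⇔-sym)
open import Relation.Binary.PropositionalEquality
open import Relation.Binary.Definitions using (DecidableEquality)
open import Relation.Nullary using (¬_; Dec; yes; no; contradiction)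
open import Relation.Nullary.Decidable using (decidable-stable; via-injection; _→-dec_)
open import Relation.Unary using (Decidable)
open import Algebra.Bundles using (CommutativeRing)
open import Algebra.Structures using (IsCommutativeRing)
import Algebra.Properties.Ring as RingProperties
import Algebra.Properties.CommutativeSemigroup as CommutativeSemigroupProperties

listToVec : ∀ {A : Set} {n} (xs : List A) → length xs ≡ n → Vec A n
listToVec []       refl = []
listToVec (x ∷ xs) refl = x ∷ listToVec xs refl

toList-listToVec : ∀ {A : Set} {n} (xs : List A) (eq : length xs ≡ n) → toList (listToVec xs eq) ≡ xs
toList-listToVec []       refl = refl
toList-listToVec (x ∷ xs) refl = cong (x ∷_) (toList-listToVec xs refl)

Pointwise-graph : ∀ {A B : Set} {R : A → B → Set} {g : A → B} →
                  (∀ x → R x (g x)) → ∀ xs → Pointwise R xs (map g xs)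
Pointwise-graph r []       = []
Pointwise-graph r (x ∷ xs) = r x ∷ Pointwise-graph r xs

Pointwise-map : ∀ {A B C : Set} {R : B → C → Set} {f : A → B} {g : A → C} →
                (∀ x → R (f x) (g x)) → ∀ xs → Pointwise R (map f xs) (map g xs)
Pointwise-map r []       = []
Pointwise-map r (x ∷ xs) = r x ∷ Pointwise-map r xs

All-∃⇒Pointwise : ∀ {A B : Set} {R : A → B → Set} {xs} → All (λ x → ∃ (R x)) xs → ∃ (Pointwise R xs)
All-∃⇒Pointwise []             = [] , []
All-∃⇒Pointwise ((y , r) ∷ rs) = Product.map (y ∷_) (r ∷_) (All-∃⇒Pointwise rs)

refute-→→ : ∀ {A B C : Set} → Dec A → Dec B → ¬ (A → B → C) → A × B × ¬ C
refute-→→ a? b? ¬f =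
  decidable-stable a? (λ ¬a → ¬f (λ a → contradiction a ¬a)) ,
  decidable-stable b? (λ ¬b → ¬f (λ _ b → contradiction b ¬b)) ,
  λ c → ¬f (λ _ _ → c)

distinct⇒1<n : ∀ {n} (i j : Fin n) → ¬ i ≡ j → 1 < n
distinct⇒1<n Fin.zero     Fin.zero     i≢j = contradiction refl i≢j
distinct⇒1<n {suc zero} Fin.zero (Fin.suc ())
distinct⇒1<n {suc zero} (Fin.suc ()) _
distinct⇒1<n {suc (suc _)} _ _ _ = s≤s (s≤s z≤n)

module _ {A : Set} {m : ℕ} (A↔Fin : A ↔ Fin m) where
  open Inverse A↔Fin

  ∀⊎∃¬ : {P : A → Set} → Decidable P → (∀ a → P a) ⊎ ∃ λ a → ¬ P a
  ∀⊎∃¬ {P} P? with FinP.all? (P? ∘ from)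
  ... | yes all = inj₁ λ a → subst P (strictlyInverseʳ a) (all (to a))
  ... | no ¬all with FinP.¬∀⟶∃¬ m (P ∘ from) (P? ∘ from) ¬all
  ...   | i , ¬p = inj₂ (from i , ¬p)

module FieldVectorProperties (F : Field) where
  open Field F public
  open IsCommutativeRing isCommutativeRing public
    using (+-identityˡ; +-identityʳ; -‿inverseʳ;
           *-assoc; *-comm; *-identityˡ; *-identityʳ; distribˡ; distribʳ; zeroˡ; zeroʳ)

  commutativeRing : CommutativeRing 0ℓ 0ℓ
  commutativeRing = record
    { Carrier = Carrier ; _≈_ = _≡_ ; _+_ = _+_ ; _*_ = _*_ ; -_ = -_ ; 0# = 0# ; 1# = 1#
    ; isCommutativeRing = isCommutativeRing }

  open RingProperties (CommutativeRing.ring commutativeRing)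
    using (-1*x≈-x; +-inverseˡ-unique; x∙y⁻¹≈ε⇒x≈y)
  open CommutativeSemigroupProperties (CommutativeRing.+-commutativeSemigroup commutativeRing)
    public using () renaming (interchange to +-interchange)

  x+-1*x≡0 : ∀ a → a + - 1# * a ≡ 0#
  x+-1*x≡0 a = trans (cong (a +_) (-1*x≈-x a)) (-‿inverseʳ a)

  x+y≡0⇒x≡-1*y : ∀ {a b} → a + b ≡ 0# → a ≡ - 1# * b
  x+y≡0⇒x≡-1*y {a} {b} eq = trans (+-inverseˡ-unique a b eq) (sym (-1*x≈-x b))

  x+-1*y≡0⇒x≡y : ∀ {a b} → a + - 1# * b ≡ 0# → a ≡ b
  x+-1*y≡0⇒x≡y {a} {b} eq = x∙y⁻¹≈ε⇒x≈y a b (trans (cong (a +_) (sym (-1*x≈-x b))) eq)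

  private module Vectors {m : ℕ} = AffineGeometry F m
  open Vectors using (_⊕_; _·_; origin)

  ⊕-identityˡ : ∀ {m} (x : Vec Carrier m) → (origin ⊕ x) ≡ x
  ⊕-identityˡ = VecP.zipWith-identityˡ +-identityˡ

  ⊕-identityʳ : ∀ {m} (x : Vec Carrier m) → (x ⊕ origin) ≡ x
  ⊕-identityʳ = VecP.zipWith-identityʳ +-identityʳ

  ⊕-interchange : ∀ {m} (w x y z : Vec Carrier m) → ((w ⊕ x) ⊕ (y ⊕ z)) ≡ ((w ⊕ y) ⊕ (x ⊕ z))
  ⊕-interchange []      []      []      []      = refl
  ⊕-interchange (a ∷ w) (b ∷ x) (c ∷ y) (d ∷ z) = cong₂ _∷_ (+-interchange a b c d) (⊕-interchange w x y z)

  ·-distribˡ : ∀ {m} c (x y : Vec Carrier m) → (c · (x ⊕ y)) ≡ ((c · x) ⊕ (c · y))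
  ·-distribˡ c []      []      = refl
  ·-distribˡ c (a ∷ x) (b ∷ y) = cong₂ _∷_ (distribˡ c a b) (·-distribˡ c x y)

  ·-distribʳ : ∀ {m} c d (x : Vec Carrier m) → ((c + d) · x) ≡ ((c · x) ⊕ (d · x))
  ·-distribʳ c d []      = refl
  ·-distribʳ c d (a ∷ x) = cong₂ _∷_ (distribʳ a c d) (·-distribʳ c d x)

  ·-assoc : ∀ {m} c d (x : Vec Carrier m) → (c · (d · x)) ≡ ((c * d) · x)
  ·-assoc c d []      = refl
  ·-assoc c d (a ∷ x) = cong₂ _∷_ (sym (*-assoc c d a)) (·-assoc c d x)

  ·-zeroˡ : ∀ {m} (x : Vec Carrier m) → (0# · x) ≡ origin
  ·-zeroˡ []      = refl
  ·-zeroˡ (a ∷ x) = cong₂ _∷_ (zeroˡ a) (·-zeroˡ x)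

  ·-zeroʳ : ∀ {m} c → (c · origin {m}) ≡ origin
  ·-zeroʳ {zero}  c = refl
  ·-zeroʳ {suc m} c = cong₂ _∷_ (zeroʳ c) (·-zeroʳ c)

  ·-identityˡ : ∀ {m} (x : Vec Carrier m) → (1# · x) ≡ x
  ·-identityˡ []      = refl
  ·-identityˡ (a ∷ x) = cong₂ _∷_ (*-identityˡ a) (·-identityˡ x)

  x⊕-1·x≡origin : ∀ {m} (x : Vec Carrier m) → (x ⊕ ((- 1#) · x)) ≡ origin
  x⊕-1·x≡origin []      = refl
  x⊕-1·x≡origin (a ∷ x) = cong₂ _∷_ (x+-1*x≡0 a) (x⊕-1·x≡origin x)

  x⊕y≡origin⇒x≡-1·y : ∀ {m} (x y : Vec Carrier m) → (x ⊕ y) ≡ origin → x ≡ ((- 1#) · y)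
  x⊕y≡origin⇒x≡-1·y []      []      eq = refl
  x⊕y≡origin⇒x≡-1·y (a ∷ x) (b ∷ y) eq =
    cong₂ _∷_ (x+y≡0⇒x≡-1*y (VecP.∷-injectiveˡ eq)) (x⊕y≡origin⇒x≡-1·y x y (VecP.∷-injectiveʳ eq))

module AffineCoordinates (F : Field) (n : ℕ) where
  open FieldVectorProperties F
  open AffineGeometry F n
  open ≡-Reasoning

  -- _+ᶜ_ pads the shorter list, so combination and sumScalars are additive in the
  -- coefficients without any length hypotheses.
  infixl 6 _+ᶜ_
  _+ᶜ_ : List Carrier → List Carrier → List Carrier
  []      +ᶜ d       = d
  (a ∷ c) +ᶜ []      = a ∷ c
  (a ∷ c) +ᶜ (b ∷ d) = (a + b) ∷ (c +ᶜ d)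

  infixr 7 _*ᶜ_
  _*ᶜ_ : Carrier → List Carrier → List Carrier
  a *ᶜ c = map (a *_) c

  0ᶜ : ℕ → List Carrier
  0ᶜ k = List.replicate k 0#

  length-+ᶜ : ∀ {k} c d → length c ≡ k → length d ≡ k → length (c +ᶜ d) ≡ k
  length-+ᶜ []      d       refl eq = eq
  length-+ᶜ (a ∷ c) []      eq   _  = eq
  length-+ᶜ (a ∷ c) (b ∷ d) refl eq = cong suc (length-+ᶜ c d refl (NatP.suc-injective eq))

  sumScalars-+ᶜ : ∀ c d → sumScalars (c +ᶜ d) ≡ sumScalars c + sumScalars d
  sumScalars-+ᶜ []      d       = sym (+-identityˡ _)
  sumScalars-+ᶜ (a ∷ c) []      = sym (+-identityʳ _)
  sumScalars-+ᶜ (a ∷ c) (b ∷ d) = trans (cong ((a + b) +_) (sumScalars-+ᶜ c d)) (+-interchange a b _ _)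

  sumScalars-*ᶜ : ∀ a c → sumScalars (a *ᶜ c) ≡ a * sumScalars c
  sumScalars-*ᶜ a []      = sym (zeroʳ a)
  sumScalars-*ᶜ a (b ∷ c) = trans (cong ((a * b) +_) (sumScalars-*ᶜ a c)) (sym (distribˡ a b _))

  sumScalars-zeros : ∀ {c} → All (_≡ 0#) c → sumScalars c ≡ 0#
  sumScalars-zeros []          = refl
  sumScalars-zeros (refl ∷ z) = trans (+-identityˡ _) (sumScalars-zeros z)

  sumScalars-0ᶜ++ : ∀ k c → sumScalars (0ᶜ k ++ c) ≡ sumScalars c
  sumScalars-0ᶜ++ zero    c = refl
  sumScalars-0ᶜ++ (suc k) c = trans (+-identityˡ _) (sumScalars-0ᶜ++ k c)

  combination-[] : ∀ bs → combination [] bs ≡ origin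
  combination-[] []      = refl
  combination-[] (_ ∷ _) = refl

  combination-+ᶜ : ∀ c d bs → combination (c +ᶜ d) bs ≡ (combination c bs ⊕ combination d bs)
  combination-+ᶜ []      d       bs       =
    trans (sym (⊕-identityˡ _)) (cong (_⊕ combination d bs) (sym (combination-[] bs)))
  combination-+ᶜ (a ∷ c) []      bs       =
    trans (sym (⊕-identityʳ _)) (cong (combination (a ∷ c) bs ⊕_) (sym (combination-[] bs)))
  combination-+ᶜ (a ∷ c) (b ∷ d) []       = sym (⊕-identityˡ origin)
  combination-+ᶜ (a ∷ c) (b ∷ d) (x ∷ bs) = begin
    (((a + b) · x) ⊕ combination (c +ᶜ d) bs)
      ≡⟨ cong₂ _⊕_ (·-distribʳ a b x) (combination-+ᶜ c d bs) ⟩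
    (((a · x) ⊕ (b · x)) ⊕ (combination c bs ⊕ combination d bs))
      ≡⟨ ⊕-interchange (a · x) (b · x) _ _ ⟩
    (((a · x) ⊕ combination c bs) ⊕ ((b · x) ⊕ combination d bs)) ∎

  combination-*ᶜ : ∀ a c bs → combination (a *ᶜ c) bs ≡ (a · combination c bs)
  combination-*ᶜ a []      bs       = trans (combination-[] bs) (sym (·-zeroʳ a))
  combination-*ᶜ a (b ∷ c) []       = sym (·-zeroʳ a)
  combination-*ᶜ a (b ∷ c) (x ∷ bs) = begin
    (((a * b) · x) ⊕ combination (a *ᶜ c) bs)
      ≡⟨ cong₂ _⊕_ (sym (·-assoc a b x)) (combination-*ᶜ a c bs) ⟩
    ((a · (b · x)) ⊕ (a · combination c bs))
      ≡⟨ sym (·-distribˡ a _ _) ⟩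
    (a · ((b · x) ⊕ combination c bs)) ∎

  combination-zeros : ∀ {c} bs → All (_≡ 0#) c → combination c bs ≡ origin
  combination-zeros bs       []          = combination-[] bs
  combination-zeros []       (refl ∷ _) = refl
  combination-zeros (x ∷ bs) (refl ∷ z) =
    trans (cong₂ _⊕_ (·-zeroˡ x) (combination-zeros bs z)) (⊕-identityˡ origin)

  combination-0ᶜ++ : ∀ p c s → combination (0ᶜ (length p) ++ c) (p ++ s) ≡ combination c s
  combination-0ᶜ++ []      c s = refl
  combination-0ᶜ++ (x ∷ p) c s = trans (cong₂ _⊕_ (·-zeroˡ x) (combination-0ᶜ++ p c s)) (⊕-identityˡ _)

  coefficients-unique : ∀ {bs} → Independent bs → ∀ {c d} →
                        length c ≡ length bs → length d ≡ length bs →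
                        sumScalars c ≡ sumScalars d → combination c bs ≡ combination d bs → c ≡ d
  coefficients-unique {bs} ind {c} {d} lc ld sc cc =
    differenceZero c d (trans lc (sym ld)) (ind (c +ᶜ - 1# *ᶜ d) lengthDiff sumDiff combDiff)
    where
    differenceZero : ∀ c d → length c ≡ length d → All (_≡ 0#) (c +ᶜ - 1# *ᶜ d) → c ≡ d
    differenceZero []      []      _  _       = refl
    differenceZero (a ∷ c) (b ∷ d) eq (z ∷ zs) =
      cong₂ _∷_ (x+-1*y≡0⇒x≡y z) (differenceZero c d (NatP.suc-injective eq) zs)
    lengthDiff : length (c +ᶜ - 1# *ᶜ d) ≡ length bs
    lengthDiff = length-+ᶜ c _ lc (trans (ListP.length-map _ d) ld)
    sumDiff : sumScalars (c +ᶜ - 1# *ᶜ d) ≡ 0#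
    sumDiff = begin
      sumScalars (c +ᶜ - 1# *ᶜ d)                 ≡⟨ sumScalars-+ᶜ c _ ⟩
      sumScalars c + sumScalars (- 1# *ᶜ d)        ≡⟨ cong₂ _+_ sc (sumScalars-*ᶜ _ d) ⟩
      sumScalars d + - 1# * sumScalars d           ≡⟨ x+-1*x≡0 _ ⟩
      0#                                           ∎
    combDiff : combination (c +ᶜ - 1# *ᶜ d) bs ≡ origin
    combDiff = begin
      combination (c +ᶜ - 1# *ᶜ d) bs                    ≡⟨ combination-+ᶜ c _ bs ⟩
      (combination c bs ⊕ combination (- 1# *ᶜ d) bs)     ≡⟨ cong₂ _⊕_ cc (combination-*ᶜ _ d bs) ⟩
      (combination d bs ⊕ ((- 1#) · combination d bs))    ≡⟨ x⊕-1·x≡origin _ ⟩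
      origin                                              ∎

  Coords : Point → List Point → List Carrier → Set
  Coords x bs c = length c ≡ length bs × sumScalars c ≡ 1# × combination c bs ≡ x

  InSpan : List Point → Point → Set
  InSpan bs x = ∃ (Coords x bs)

  coords-unique : ∀ {bs x c d} → Independent bs → Coords x bs c → Coords x bs d → c ≡ d
  coords-unique ind (lc , sc , cc) (ld , sd , cd) =
    coefficients-unique ind lc ld (trans sc (sym sd)) (trans cc (sym cd))

  coords-∷ : ∀ y s → Coords y (y ∷ s) (1# ∷ 0ᶜ (length s))
  coords-∷ y s =
    cong suc (ListP.length-replicate (length s)) ,
    trans (cong (1# +_) (sumScalars-zeros (replicate⁺ (length s) refl))) (+-identityʳ 1#) ,
    trans (cong₂ _⊕_ (·-identityˡ y) (combination-zeros s (replicate⁺ (length s) refl))) (⊕-identityʳ y)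

  coords-++⁺ : ∀ p {s x c} → Coords x s c → Coords x (p ++ s) (0ᶜ (length p) ++ c)
  coords-++⁺ p {s} {x} {c} (lc , sc , cc) =
    trans (ListP.length-++ (0ᶜ (length p)))
          (trans (cong₂ Nat._+_ (ListP.length-replicate (length p)) lc) (sym (ListP.length-++ p))) ,
    trans (sumScalars-0ᶜ++ (length p) c) sc ,
    trans (combination-0ᶜ++ p c s) cc

  coords-++⁻ : ∀ p {s x d} → length d ≡ length s → Coords x (p ++ s) (0ᶜ (length p) ++ d) → Coords x s d
  coords-++⁻ p {s} {x} {d} ld (_ , sc , cc) =
    ld , trans (sym (sumScalars-0ᶜ++ (length p) d)) sc , trans (sym (combination-0ᶜ++ p d s)) cc

  coords-∈-flat : ∀ {X bs x c} → IsFlat X → All (_∈ X) bs → Coords x bs c → x ∈ X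
  coords-∈-flat {X} {bs} {c = c} flat bsX (lc , sc , cc) = subst X cc (flat bs c bsX lc sc)

  CoordsList : List Point → List Point → List (List Carrier) → Set
  CoordsList bs = Pointwise (λ x c → Coords x bs c)

  -- The coefficients Σᵢ vᵢ Cᵢ of Σᵢ vᵢ xᵢ when Cs lists the coordinates of the xᵢ;
  -- b is only the length of the padding for empty v.
  combineCoords : ℕ → List Carrier → List (List Carrier) → List Carrier
  combineCoords b (v ∷ vs) (C ∷ Cs) = v *ᶜ C +ᶜ combineCoords b vs Cs
  combineCoords b _        _        = 0ᶜ b

  length-combineCoords : ∀ {bs xs Cs} v → CoordsList bs xs Cs →
                         length (combineCoords (length bs) v Cs) ≡ length bs
  length-combineCoords {bs} []       _                     = ListP.length-replicate (length bs)
  length-combineCoords {bs} (v ∷ vs) []                    = ListP.length-replicate (length bs)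
  length-combineCoords {bs} {Cs = C ∷ Cs} (v ∷ vs) ((lC , _ , _) ∷ rest) =
    length-+ᶜ (v *ᶜ C) _ (trans (ListP.length-map _ C) lC) (length-combineCoords vs rest)

  sumScalars-combineCoords : ∀ {bs xs Cs} b v → CoordsList bs xs Cs → length v ≡ length xs →
                             sumScalars (combineCoords b v Cs) ≡ sumScalars v
  sumScalars-combineCoords b []       [] _ = sumScalars-zeros (replicate⁺ b refl)
  sumScalars-combineCoords {Cs = C ∷ Cs} b (v ∷ vs) ((_ , sC , _) ∷ rest) lv = begin
    sumScalars (v *ᶜ C +ᶜ combineCoords b vs Cs)                  ≡⟨ sumScalars-+ᶜ (v *ᶜ C) _ ⟩
    sumScalars (v *ᶜ C) + sumScalars (combineCoords b vs Cs)       ≡⟨ cong₂ _+_ scaled rest′ ⟩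
    v + sumScalars vs                                              ∎
    where
    scaled = trans (sumScalars-*ᶜ v C) (trans (cong (v *_) sC) (*-identityʳ v))
    rest′  = sumScalars-combineCoords b vs rest (NatP.suc-injective lv)

  combination-combineCoords : ∀ {bs xs Cs} b v → CoordsList bs xs Cs →
                              combination (combineCoords b v Cs) bs ≡ combination v xs
  combination-combineCoords {bs} {xs} b []       _  =
    trans (combination-zeros bs (replicate⁺ b refl)) (sym (combination-[] xs))
  combination-combineCoords {bs}      b (v ∷ vs) [] = combination-zeros bs (replicate⁺ b refl)
  combination-combineCoords {bs} {x ∷ xs} {C ∷ Cs} b (v ∷ vs) ((_ , _ , cC) ∷ rest) = begin
    combination (v *ᶜ C +ᶜ combineCoords b vs Cs) bs
      ≡⟨ combination-+ᶜ (v *ᶜ C) _ bs ⟩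
    (combination (v *ᶜ C) bs ⊕ combination (combineCoords b vs Cs) bs)
      ≡⟨ cong₂ _⊕_ (trans (combination-*ᶜ v C bs) (cong (v ·_) cC)) (combination-combineCoords b vs rest) ⟩
    ((v · x) ⊕ combination vs xs) ∎

  -- A dependence cs of the yᵢ yields the dependence Σᵢ csᵢ Cᵢ of bs′, which vanishes;
  -- hence cs is also a dependence of the xᵢ.
  independent-transfer : ∀ {bs bs′ xs ys Cs} → CoordsList bs xs Cs → CoordsList bs′ ys Cs →
                         Independent bs′ → Independent xs → Independent ys
  independent-transfer {bs} {bs′} {xs} {ys} {Cs} xsC ysC ind′ indXs cs lcs scs ccs =
    indXs cs (trans lcs lengthYs≡Xs) scs combXs
    where
    lengthYs≡Xs : length ys ≡ length xs
    lengthYs≡Xs = trans (Pointwise-length ysC) (sym (Pointwise-length xsC))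
    b = length bs′
    coefficientsZero : All (_≡ 0#) (combineCoords b cs Cs)
    coefficientsZero = ind′ _ (length-combineCoords cs ysC)
      (trans (sumScalars-combineCoords b cs ysC lcs) scs) (trans (combination-combineCoords b cs ysC) ccs)
    combXs : combination cs xs ≡ origin
    combXs = trans (sym (combination-combineCoords b cs xsC)) (combination-zeros bs coefficientsZero)

  transport : ∀ {e} → (∀ x → InSpan e x) → List Point → Point → Point
  transport spans e′ x = combination (proj₁ (spans x)) e′

  transport-coords : ∀ {e e′} (spans : ∀ x → InSpan e x) → length e ≡ length e′ →
                     ∀ x → Coords (transport spans e′ x) e′ (proj₁ (spans x))
  transport-coords spans e≡e′ x = let (le , se , _) = proj₂ (spans x) in trans le e≡e′ , se , refl

  transport-inverse : ∀ {e e′} (spans : ∀ x → InSpan e x) (spans′ : ∀ y → InSpan e′ y) →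
                      Independent e′ → length e ≡ length e′ →
                      ∀ x → transport spans′ e (transport spans e′ x) ≡ x
  transport-inverse {e} {e′} spans spans′ ind′ e≡e′ x = begin
    combination (proj₁ (spans′ y)) e  ≡⟨ cong (λ c → combination c e) sameCoords ⟩
    combination (proj₁ (spans x)) e   ≡⟨ proj₂ (proj₂ (proj₂ (spans x))) ⟩
    x                                 ∎
    where
    y = transport spans e′ x
    sameCoords : proj₁ (spans′ y) ≡ proj₁ (spans x)
    sameCoords = coords-unique ind′ (proj₂ (spans′ y)) (transport-coords spans e≡e′ x)

  transport-independent : ∀ {e e′} (spans : ∀ x → InSpan e x) → Independent e → Independent e′ →
                          length e ≡ length e′ →
                          ∀ xs → Independent xs ⇔ Independent (map (transport spans e′) xs)
  transport-independent spans ind ind′ e≡e′ xs =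
    mk⇔ (independent-transfer xsC ysC ind′) (independent-transfer ysC xsC ind)
    where
    xsC = Pointwise-graph (proj₂ ∘ spans) xs
    ysC = Pointwise-map {g = proj₁ ∘ spans} (transport-coords spans e≡e′) xs

  record IsBasis (X : Subset) (s : List Point) : Set where
    field
      independent : Independent s
      members     : All (_∈ X) s
      maximum     : ∀ xs → All (_∈ X) xs → Independent xs → length xs ≤ length s

  basis-length : ∀ {X s m} → IsBasis X s → HasRank X m → length s ≡ m
  basis-length b ((M , M⊆X , indM , refl) , bound) =
    NatP.≤-antisym (bound _ members independent) (maximum M M⊆X indM)
    where open IsBasis b

  SupportedOnLast : ℕ → List Carrier → Set
  SupportedOnLast m c = ∃₂ λ z d → length d ≡ m × c ≡ 0ᶜ z ++ d

  record AdaptedBasis (k : ℕ) (X : ℕ → Subset) : Set where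
    field
      basis        : List Point
      independent  : Independent basis
      spans        : ∀ x → InSpan basis x
      length-basis : ∀ {m} → HasRank (X k) m → length basis ≡ m
      ∈⇔supported  : ∀ j → j ≤ k → ∀ {m} → HasRank (X j) m →
                     ∀ {x c} → Coords x basis c → x ∈ X j ⇔ SupportedOnLast m c

  record FlagIsomorphism (k : ℕ) (E G : ℕ → Subset) : Set where
    field
      to from        : Point → Point
      from∘to        : ∀ x → from (to x) ≡ x
      to∘from        : ∀ y → to (from y) ≡ y
      to-∈           : ∀ j → j ≤ k → ∀ x → x ∈ E j ⇔ to x ∈ G j
      to-independent : ∀ xs → Independent xs ⇔ Independent (map to xs)

  evenLayers-preserved : ∀ {k} {E G : ℕ → Subset} {f : Point → Point} →
                         (∀ j → j ≤ k → ∀ x → x ∈ E j ⇔ f x ∈ G j) →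
                         ∀ x → x ∈ EvenLayers k E → f x ∈ EvenLayers k G
  evenLayers-preserved f-∈ x (j , 2j<k , inNext , notIn) =
    j , 2j<k , Equivalence.to (f-∈ _ 2j<k x) inNext , notIn ∘ Equivalence.from (f-∈ _ (NatP.<⇒≤ 2j<k) x)

  evenLayersIso : ∀ {k E G} → FlagIsomorphism k E G → RestrictionIso (EvenLayers k E) (EvenLayers k G)
  evenLayersIso {k} {E} {G} iso =
    to , from , evenLayers-preserved {G = G} {to} to-∈ , evenLayers-preserved {G = E} {from} from-∈ ,
    (λ x _ → from∘to x) , (λ y _ → to∘from y) , (λ xs _ → to-independent xs)
    where
    open FlagIsomorphism iso
    from-∈ : ∀ j → j ≤ k → ∀ y → y ∈ G j ⇔ from y ∈ E j
    from-∈ j j≤k y = ⇔-sym (subst (λ z → from y ∈ E j ⇔ z ∈ G j) (to∘from y) (to-∈ j j≤k (from y)))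

  flagIsomorphism : ∀ {k E G} → AdaptedBasis k E → AdaptedBasis k G →
                    (∀ j → j ≤ k → ∃[ m ] (HasRank (E j) m × HasRank (G j) m)) → FlagIsomorphism k E G
  flagIsomorphism {k} {E} {G} 𝓔 𝓖 sameRank = record
    { to             = transport (spans 𝓔) (basis 𝓖)
    ; from           = transport (spans 𝓖) (basis 𝓔)
    ; from∘to        = transport-inverse (spans 𝓔) (spans 𝓖) (independent 𝓖) lengths
    ; to∘from        = transport-inverse (spans 𝓖) (spans 𝓔) (independent 𝓔) (sym lengths)
    ; to-∈           = to-∈
    ; to-independent = transport-independent (spans 𝓔) (independent 𝓔) (independent 𝓖) lengths
    }
    where
    open AdaptedBasis
    lengths : length (basis 𝓔) ≡ length (basis 𝓖)
    lengths with sameRank k NatP.≤-refl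
    ... | _ , rankE , rankG = trans (length-basis 𝓔 rankE) (sym (length-basis 𝓖 rankG))
    to-∈ : ∀ j → j ≤ k → ∀ x → x ∈ E j ⇔ transport (spans 𝓔) (basis 𝓖) x ∈ G j
    to-∈ j j≤k x with sameRank j j≤k
    ... | _ , rankE , rankG =
      ⇔-sym (∈⇔supported 𝓖 j j≤k rankG (transport-coords (spans 𝓔) lengths x))
        ⇔-∘ ∈⇔supported 𝓔 j j≤k rankE {c = proj₁ (spans 𝓔 x)} (proj₂ (spans 𝓔 x))

module FiniteField (F : Field) {q : ℕ} (K↔Fin : Field.Carrier F ↔ Fin q) where
  open FieldVectorProperties F

  Vec↔Fin : ∀ L → Vec Carrier L ↔ Fin (q ^ L)
  Vec↔Fin L = ↔-trans (↔-sym (↔Vec L)) (↔-trans (lift↔ L K↔Fin) (↔-sym (Fin[m^n]↔Fin[m]^n q L)))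

  card-mono : ∀ {a b} (f : Vec Carrier a → Vec Carrier b) → Injective _≡_ _≡_ f → q ^ a ≤ q ^ b
  card-mono {a} {b} f f-injective = FinP.injective⇒≤ {f = Injection.to fin} (Injection.injective fin)
    where
    fin : Fin (q ^ a) ↣ Fin (q ^ b)
    fin = ↔⇒↣ (Vec↔Fin b) ↣-∘ (mk↣ f-injective ↣-∘ ↔⇒↣ (↔-sym (Vec↔Fin a)))

  _≟_ : DecidableEquality Carrier
  _≟_ = via-injection (↔⇒↣ K↔Fin) Fin._≟_

  1<q : 1 < q
  1<q = distinct⇒1<n (to 0#) (to 1#) (0≢1 ∘ Injection.injective (↔⇒↣ K↔Fin))
    where open Inverse K↔Fin

  ^-cancelˡ-≤ : ∀ {a b} → q ^ a ≤ q ^ b → a ≤ b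
  ^-cancelˡ-≤ qᵃ≤qᵇ = NatP.≮⇒≥ (λ b<a → NatP.<⇒≱ (NatP.^-monoʳ-< q 1<q b<a) qᵃ≤qᵇ)

module FiniteAffineGeometry (F : Field) {q : ℕ} (K↔Fin : Field.Carrier F ↔ Fin q) (n : ℕ) where
  open FieldVectorProperties F
  open FiniteField F K↔Fin
  open AffineGeometry F n
  open AffineCoordinates F n
  open ≡-Reasoning

  Dependence : List Point → Set
  Dependence xs = ∃ λ cs → length cs ≡ length xs × sumScalars cs ≡ 0# ×
                           combination cs xs ≡ origin × ¬ All (_≡ 0#) cs

  NullImpliesZero : List Point → List Carrier → Set
  NullImpliesZero xs cs = sumScalars cs ≡ 0# → combination cs xs ≡ origin → All (_≡ 0#) cs

  nullImpliesZero? : ∀ xs → Decidable (NullImpliesZero xs)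
  nullImpliesZero? xs cs =
    (sumScalars cs ≟ 0#) →-dec ((VecP.≡-dec _≟_ (combination cs xs) origin) →-dec All.all? (_≟ 0#) cs)

  independent⊎dependent : ∀ xs → Independent xs ⊎ Dependence xs
  independent⊎dependent xs with ∀⊎∃¬ (Vec↔Fin (length xs)) (nullImpliesZero? xs ∘ toList)
  ... | inj₁ all      = inj₁ λ cs lcs →
    subst (NullImpliesZero xs) (toList-listToVec cs lcs) (all (listToVec cs lcs))
  ... | inj₂ (v , ¬p) = inj₂ (toList v , VecP.length-toList v ,
    refute-→→ (_ ≟ _) (VecP.≡-dec _≟_ _ _) ¬p)

  -- From t x + Σ cᵢ sᵢ = 0 with Σ cᵢ = -t: t ≠ 0 by independence of s, and dividing by -t
  -- expresses x as an affine combination of s.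
  dependent-∷⇒InSpan : ∀ {x s} → Independent s → Dependence (x ∷ s) → InSpan s x
  dependent-∷⇒InSpan ind ([] , () , _)
  dependent-∷⇒InSpan {x} {s} ind (t ∷ c , lc , sc , cc , nonzero) with t ≟ 0#
  ... | yes refl = contradiction (refl ∷ ind c (NatP.suc-injective lc) sc′ cc′) nonzero
    where
    sc′ : sumScalars c ≡ 0#
    sc′ = trans (sym (+-identityˡ _)) sc
    cc′ : combination c s ≡ origin
    cc′ = trans (sym (⊕-identityˡ _)) (trans (cong (_⊕ combination c s) (sym (·-zeroˡ x))) cc)
  ... | no t≢0 with inverse t t≢0
  ...   | u , tu≡1 = (u * - 1#) *ᶜ c , trans (ListP.length-map _ c) (NatP.suc-injective lc) , sumOne , combX
    where
    ut≡1 : u * t ≡ 1#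
    ut≡1 = trans (*-comm u t) tu≡1
    sumOne : sumScalars ((u * - 1#) *ᶜ c) ≡ 1#
    sumOne = begin
      sumScalars ((u * - 1#) *ᶜ c)   ≡⟨ sumScalars-*ᶜ (u * - 1#) c ⟩
      (u * - 1#) * sumScalars c      ≡⟨ *-assoc u (- 1#) _ ⟩
      u * (- 1# * sumScalars c)      ≡⟨ cong (u *_) (sym (x+y≡0⇒x≡-1*y sc)) ⟩
      u * t                          ≡⟨ ut≡1 ⟩
      1#                             ∎
    combX : combination ((u * - 1#) *ᶜ c) s ≡ x
    combX = begin
      combination ((u * - 1#) *ᶜ c) s       ≡⟨ combination-*ᶜ (u * - 1#) c s ⟩
      ((u * - 1#) · combination c s)        ≡⟨ sym (·-assoc u (- 1#) _) ⟩
      (u · ((- 1#) · combination c s))      ≡⟨ cong (u ·_) (sym (x⊕y≡origin⇒x≡-1·y (t · x) _ cc)) ⟩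
      (u · (t · x))                         ≡⟨ ·-assoc u t x ⟩
      ((u * t) · x)                         ≡⟨ cong (_· x) ut≡1 ⟩
      (1# · x)                              ≡⟨ ·-identityˡ x ⟩
      x                                     ∎

  -- Exchange lemma, by counting: the coordinates with respect to bs of Σ vᵢ mᵢ determine
  -- the vector v, so q ^ length ms ≤ q ^ length bs.
  steinitz : ∀ {ms bs} → Independent ms → All (InSpan bs) ms → length ms ≤ length bs
  steinitz {ms} {bs} ind spanned = ^-cancelˡ-≤ (card-mono f f-injective)
    where
    coordsOfMs = All-∃⇒Pointwise {R = λ m c → Coords m bs c} spanned
    Cs = proj₁ coordsOfMs
    msC : CoordsList bs ms Cs
    msC = proj₂ coordsOfMs
    b = length bs
    g : List Carrier → List Carrier
    g v = combineCoords b v Cs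
    f : Vec Carrier (length ms) → Vec Carrier b
    f v = listToVec (g (toList v)) (length-combineCoords (toList v) msC)
    f-injective : Injective _≡_ _≡_ f
    f-injective {v} {w} fv≡fw =
      trans (sym (VecP.cast-is-id refl v))
            (VecP.toList-injective refl v w (coefficients-unique ind lv lw sums combs))
      where
      lv = VecP.length-toList v
      lw = VecP.length-toList w
      gv≡gw : g (toList v) ≡ g (toList w)
      gv≡gw = begin
        g (toList v)    ≡⟨ sym (toList-listToVec _ _) ⟩
        toList (f v)    ≡⟨ cong toList fv≡fw ⟩
        toList (f w)    ≡⟨ toList-listToVec _ _ ⟩
        g (toList w)    ∎
      sums : sumScalars (toList v) ≡ sumScalars (toList w)
      sums = begin
        sumScalars (toList v)      ≡⟨ sym (sumScalars-combineCoords b (toList v) msC lv) ⟩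
        sumScalars (g (toList v))  ≡⟨ cong sumScalars gv≡gw ⟩
        sumScalars (g (toList w))  ≡⟨ sumScalars-combineCoords b (toList w) msC lw ⟩
        sumScalars (toList w)      ∎
      combs : combination (toList v) ms ≡ combination (toList w) ms
      combs = begin
        combination (toList v) ms       ≡⟨ sym (combination-combineCoords b (toList v) msC) ⟩
        combination (g (toList v)) bs   ≡⟨ cong (λ c → combination c bs) gv≡gw ⟩
        combination (g (toList w)) bs   ≡⟨ combination-combineCoords b (toList w) msC ⟩
        combination (toList w) ms       ∎

  basis-spans : ∀ {X s x} → IsBasis X s → x ∈ X → InSpan s x
  basis-spans {X} {s} {x} b x∈X with independent⊎dependent (x ∷ s)
  ... | inj₁ ind = contradiction (IsBasis.maximum b (x ∷ s) (x∈X ∷ IsBasis.members b) ind) NatP.1+n≰n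
  ... | inj₂ dep = dependent-∷⇒InSpan (IsBasis.independent b) dep

  greedyExtension : ∀ {X s} → Independent s → All (_∈ X) s → ∀ M → All (_∈ X) M →
                    ∃ λ new → Independent (new ++ s) × All (_∈ X) (new ++ s) × All (InSpan (new ++ s)) M
  greedyExtension ind s⊆X []      []          = [] , ind , s⊆X , []
  greedyExtension {X} {s} ind s⊆X (y ∷ M) (y∈X ∷ M⊆X) with greedyExtension ind s⊆X M M⊆X
  ... | new , ind′ , ⊆X , spanned with independent⊎dependent (y ∷ new ++ s)
  ...   | inj₁ ind″ = y ∷ new , ind″ , y∈X ∷ ⊆X ,
                      (1# ∷ 0ᶜ (length (new ++ s)) , coords-∷ y (new ++ s)) ∷
                      All.map (λ (c , xc) → 0# ∷ c , coords-++⁺ (y ∷ []) {new ++ s} {c = c} xc) spanned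
  ...   | inj₂ dep  = new , ind′ , ⊆X , dependent-∷⇒InSpan ind′ dep ∷ spanned

  extendToBasis : ∀ {X s m} → Independent s → All (_∈ X) s → HasRank X m → ∃ λ new → IsBasis X (new ++ s)
  extendToBasis ind s⊆X ((M , M⊆X , indM , refl) , bound) with greedyExtension ind s⊆X M M⊆X
  ... | new , ind′ , ⊆X , spanned = new , record
    { independent = ind′
    ; members     = ⊆X
    ; maximum     = λ xs xs⊆X indXs → NatP.≤-trans (bound xs xs⊆X indXs) (steinitz indM spanned)
    }

  independent-[] : Independent []
  independent-[] [] _ _ _ = []

  []-isBasis : ∀ {X} → (∀ x → ¬ x ∈ X) → IsBasis X []
  []-isBasis empty = record
    { independent = independent-[]
    ; members     = []
    ; maximum     = λ { [] _ _ → z≤n ; (x ∷ _) (x∈X ∷ _) _ → contradiction x∈X (empty x) }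
    }

  module _ {k : ℕ} {X : ℕ → Subset} (nested : NestedFlats k X) where
    private
      flats = proj₁ nested
      empty = proj₁ (proj₂ nested)
      step  = proj₁ (proj₂ (proj₂ nested))
      full  = proj₂ (proj₂ (proj₂ nested))

    Adapted : ℕ → List Point → Set
    Adapted i s = ∀ j → j ≤ i → ∃₂ λ p t → s ≡ p ++ t × IsBasis (X j) t

    adapted-++ : ∀ {i s} new → Adapted i s → IsBasis (X (suc i)) (new ++ s) → Adapted (suc i) (new ++ s)
    adapted-++ new adapted b j j≤1+i with NatP.m≤n⇒m<n∨m≡n j≤1+i
    ... | inj₂ refl = [] , _ , refl , b
    ... | inj₁ j<1+i with adapted j (NatP.≤-pred j<1+i)
    ...   | p , t , refl , bt = new ++ p , t , sym (ListP.++-assoc new p t) , bt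

    adaptedList : (∀ i → i ≤ k → ∃ (HasRank (X i))) →
                  ∀ i → i ≤ k → ∃ λ s → IsBasis (X i) s × Adapted i s
    adaptedList rank zero    _     =
      [] , []-isBasis empty , λ { zero z≤n → [] , [] , refl , []-isBasis empty }
    adaptedList rank (suc i) 1+i≤k with adaptedList rank i (NatP.≤-trans (NatP.n≤1+n i) 1+i≤k)
    ... | s , b , adapted with extendToBasis (IsBasis.independent b)
                                             (All.map (step i 1+i≤k _) (IsBasis.members b))
                                             (proj₂ (rank (suc i) 1+i≤k))
    ...   | new , b′ = new ++ s , b′ , adapted-++ new adapted b′

    adapted-∈⇔ : ∀ {e} → Independent e → Adapted k e → ∀ j → j ≤ k → ∀ {m} → HasRank (X j) m →
                 ∀ {x c} → Coords x e c → x ∈ X j ⇔ SupportedOnLast m c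
    adapted-∈⇔ ind adapted j j≤k {m} rank {x} {c} xc with adapted j j≤k
    ... | p , t , refl , bt = mk⇔ supported member
      where
      lt : length t ≡ m
      lt = basis-length bt rank
      supported : x ∈ X j → SupportedOnLast m c
      supported x∈X with basis-spans bt x∈X
      ... | d , xd = length p , d , trans (proj₁ xd) lt , coords-unique ind xc (coords-++⁺ p {c = d} xd)
      member : SupportedOnLast m c → x ∈ X j
      member (z , d , ld , c≡0ᶻ++d) =
        coords-∈-flat {c = d} (flats j j≤k) (IsBasis.members bt)
                      (coords-++⁻ p {d = d} (trans ld (sym lt)) xc′)
        where
        z≡|p| : z ≡ length p
        z≡|p| = NatP.+-cancelʳ-≡ m z (length p) (begin
          z Nat.+ m                       ≡⟨ cong₂ Nat._+_ (sym (ListP.length-replicate z)) (sym ld) ⟩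
          length (0ᶜ z) Nat.+ length d    ≡⟨ sym (ListP.length-++ (0ᶜ z)) ⟩
          length (0ᶜ z ++ d)              ≡⟨ cong length (sym c≡0ᶻ++d) ⟩
          length c                        ≡⟨ proj₁ xc ⟩
          length (p ++ t)                 ≡⟨ ListP.length-++ p ⟩
          length p Nat.+ length t         ≡⟨ cong (length p Nat.+_) lt ⟩
          length p Nat.+ m                ∎)
        xc′ : Coords x (p ++ t) (0ᶜ (length p) ++ d)
        xc′ = subst (Coords x (p ++ t)) (trans c≡0ᶻ++d (cong (λ z → 0ᶜ z ++ d) z≡|p|)) xc

    adaptedBasis : (∀ i → i ≤ k → ∃ (HasRank (X i))) → AdaptedBasis k X
    adaptedBasis rank with adaptedList rank k NatP.≤-refl
    ... | e , b , adapted = record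
      { basis        = e
      ; independent  = IsBasis.independent b
      ; spans        = λ x → basis-spans b (full x)
      ; length-basis = basis-length b
      ; ∈⇔supported  = adapted-∈⇔ (IsBasis.independent b) adapted
      }

proposition4p1 : ∀ (q : ℕ) → IsPrimePower q →
    ∀ (F : Field) → HasOrder F q →
    ∀ (r : ℕ) → r ≥ 1 →
    let open AffineGeometry F (r ∸ 1) in
    ∀ (k : ℕ) (E G : ℕ → Subset) →
    NestedFlats k E → NestedFlats k G →
    (∀ i → i ≤ k → ∃[ m ] (HasRank (E i) m × HasRank (G i) m)) →
    RestrictionIso (EvenLayers k E) (EvenLayers k G)
proposition4p1 q _ F K↔Fin r _ k E G nestedE nestedG sameRank =
  evenLayersIso (flagIsomorphism (adaptedBasis nestedE rankE) (adaptedBasis nestedG rankG) sameRank)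
  where
  open AffineCoordinates F (r ∸ 1)
  open FiniteAffineGeometry F K↔Fin (r ∸ 1)
  rankE = λ i i≤k → Product.map₂ proj₁ (sameRank i i≤k)
  rankG = λ i i≤k → Product.map₂ proj₂ (sameRank i i≤k)
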